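{- Let $U$ be an $(h,k)_q$-evasive subspace of $V=V(r,q^n)$. Then for every integer $s$ with $0\le s<h$, $U$ is also $(h-s,k-s)_q$-evasive.
   Context: $V(r,q^n)$ denotes an $r$-dimensional vector space over $\mathbb{F}_{q^n}$, viewed also as an $rn$-dimensional vector space over $\mathbb{F}_q$. For positive integers $h,k$, an $\mathbb{F}_q$-subspace $U$ of $V$ is called $(h,k)_q$-evasive if the $\mathbb{F}_{q^n}$-span $\langle U\rangle_{\mathbb{F}_{q^n}}$ has $\mathbb{F}_{q^n}$-dimension at least $h$ and every $h$-dimensional $\mathbb{F}_{q^n}$-subspace of $V$ meets $U$ in an $\mathbb{F}_q$-subspace of $\mathbb{F}_q$-dimension at most $k$. -}

module Defs where

open import Data.Nat using (ℕ; _^_; _≤_)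
open import Data.Fin using (Fin; zero; suc)
open import Data.Bool using (Bool; T)
open import Data.Unit using (⊤)
open import Data.Product using (Σ; _×_; ∃)
open import Relation.Nullary using (¬_)
open import Relation.Binary.PropositionalEquality using (_≡_)
open import Algebra.Structures using (IsCommutativeRing)
open import Function.Bundles using (_↔_)

-- A finite field L = F_{q^n} (|L| = q^n) together with its subfield
-- K = F_q (|K| = q), given as a decidable subset of L closed under the
-- field operations.  Equality is propositional equality.
record FieldExt (q n : ℕ) : Set₁ where
  infixl 6 _+_
  infixl 7 _*_
  field
    L     : Set
    0# 1# : L
    _+_ _*_ : L → L → L
    -_    : L → L
    isCommutativeRing : IsCommutativeRing _≡_ _+_ _*_ -_ 0# 1#
    0≢1   : ¬ (0# ≡ 1#)
    inverse : ∀ x → ¬ (x ≡ 0#) → Σ L (λ y → x * y ≡ 1#)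
    cardL : L ↔ Fin (q ^ n)
    inK   : L → Bool
    K-0   : T (inK 0#)
    K-1   : T (inK 1#)
    K-+   : ∀ x y → T (inK x) → T (inK y) → T (inK (x + y))
    K-*   : ∀ x y → T (inK x) → T (inK y) → T (inK (x * y))
    K--   : ∀ x → T (inK x) → T (inK (- x))
    K-inv : ∀ x y → T (inK x) → x * y ≡ 1# → T (inK y)
    cardK : Σ L (λ x → T (inK x)) ↔ Fin q

module VectorSpace {q n : ℕ} (F : FieldExt q n) (r : ℕ) where
  open FieldExt F

  V : Set
  V = Fin r → L

  _≈_ : V → V → Set
  u ≈ v = ∀ i → u i ≡ v i

  0V : V
  0V _ = 0#

  _⊕_ : V → V → V
  (u ⊕ v) i = u i + v i

  _·_ : L → V → V
  (c · v) i = c * v i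

  lincomb : ∀ {d} → (Fin d → L) → (Fin d → V) → V
  lincomb {ℕ.zero}  c w = 0V
  lincomb {ℕ.suc d} c w = (c zero · w zero) ⊕ lincomb (λ i → c (suc i)) (λ i → w (suc i))

  -- Scalar sets: S = K (the subfield F_q) or S = all of L (F_{q^n})
  ScalK : L → Set
  ScalK x = T (inK x)

  ScalL : L → Set
  ScalL _ = ⊤

  record IsSubspace (S : L → Set) (U : V → Set) : Set where
    field
      resp  : ∀ {u v} → u ≈ v → U u → U v
      zero∈ : U 0V
      +∈    : ∀ {u v} → U u → U v → U (u ⊕ v)
      ·∈    : ∀ {c v} → S c → U v → U (c · v)

  Independent : (S : L → Set) → ∀ {d} → (Fin d → V) → Set
  Independent S {d} w =
    (c : Fin d → L) → (∀ i → S (c i)) → lincomb c w ≈ 0V → ∀ i → c i ≡ 0#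

  DimAtLeast : (S : L → Set) → (V → Set) → ℕ → Set
  DimAtLeast S U d =
    Σ (Fin d → V) (λ w → (∀ i → U (w i)) × Independent S w)

  DimAtMost : (S : L → Set) → (V → Set) → ℕ → Set
  DimAtMost S U k =
    ∀ d (w : Fin d → V) → (∀ i → U (w i)) → Independent S w → d ≤ k

  SpanL : (V → Set) → V → Set
  SpanL U v = Σ ℕ (λ d → Σ (Fin d → V) (λ w → Σ (Fin d → L) (λ c →
                (∀ i → U (w i)) × (v ≈ lincomb c w))))

  Evasive : ℕ → ℕ → (V → Set) → Set₁
  Evasive h k U =
    DimAtLeast ScalL (SpanL U) h ×
    ((W : V → Set) → IsSubspace ScalL W → DimAtLeast ScalL W h → DimAtMost ScalL W h →
      DimAtMost ScalK (λ v → U v × W v) k)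

module Submission where

-- It suffices to show that (h+1,k)-evasive implies (h,k-1)-evasive and to
-- iterate.  The span condition descends by discarding one vector of an
-- independent family of ⟨U⟩.  For the intersection condition, let W be an
-- F_{q^n}-subspace of dimension exactly h and x_1..x_d an F_q-independent
-- family in U ∩ W.  As dim ⟨U⟩ ≥ h+1 > dim W, some u ∈ U lies outside W;
-- then W' = W + ⟨u⟩ has dimension exactly h+1 and u,x_1..x_d is
-- F_q-independent in U ∩ W', so d+1 ≤ k.  Membership in W is undecidable,
-- so u only exists under a double negation, which is harmless because the
-- conclusion d ≤ k-1 is decidable.

open import Defs
open import Data.Nat using (ℕ; _≤_; _<_; _∸_)
import Data.Nat as Nat
import Data.Nat.Properties as NatP
open import Data.Fin using (Fin; zero; suc; punchIn)
import Data.Fin.Properties as FinP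
open import Data.Vec.Functional using (_∷_; insertAt)
open import Data.Vec.Functional.Properties using (insertAt-punchIn)
open import Data.Product using (Σ; _×_; _,_; proj₁; proj₂)
open import Data.Unit using (tt)
open import Data.Empty using (⊥-elim)
open import Relation.Nullary using (¬_; Dec; yes; no)
open import Relation.Nullary.Decidable using (decidable-stable; via-injection)
open import Relation.Binary.PropositionalEquality
open import Function.Properties.Inverse using (↔⇒↣)
open import Algebra.Bundles using (CommutativeRing)
open import Algebra.Structures using (IsCommutativeRing)
import Algebra.Solver.Ring.NaturalCoefficients.Default as SemiringSolver
import Algebra.Properties.Ring as RingProperties

¬¬-∀-Fin : ∀ {d} (P : Fin d → Set) → (∀ i → ¬ ¬ P i) → ¬ ¬ (∀ i → P i)
¬¬-∀-Fin {Nat.zero}  P ¬¬P ¬∀P = ¬∀P (λ ())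
¬¬-∀-Fin {Nat.suc d} P ¬¬P ¬∀P =
  ¬¬P zero (λ P₀ → ¬¬-∀-Fin (λ i → P (suc i)) (λ i → ¬¬P (suc i))
    (λ Pₛ → ¬∀P (λ { zero → P₀ ; (suc i) → Pₛ i })))

module FieldFacts {q n : ℕ} (F : FieldExt q n) where
  open FieldExt F
  open IsCommutativeRing isCommutativeRing
    using ( +-identityˡ; +-identityʳ; *-identityˡ; *-identityʳ
          ; zeroˡ; zeroʳ; -‿inverseˡ; -‿inverseʳ)
  open ≡-Reasoning

  private
    ring : CommutativeRing _ _
    ring = record { isCommutativeRing = isCommutativeRing }
    module Solver = SemiringSolver (CommutativeRing.commutativeSemiring ring)
    open Solver using (solve; _:=_; _:+_; _:*_)
    open RingProperties (CommutativeRing.ring ring) using (-‿distribˡ-*)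

  _≟_ : (x y : L) → Dec (x ≡ y)
  _≟_ = via-injection (↔⇒↣ cardL) FinP._≟_

  0*-+ : ∀ x b → 0# * x + b ≡ b
  0*-+ x b = trans (cong (_+ b) (zeroˡ x)) (+-identityˡ b)

  +-0* : ∀ x u → x + 0# * u ≡ x
  +-0* x u = trans (cong (x +_) (zeroˡ u)) (+-identityʳ x)

  +-exchange : ∀ a b c → a + (b + c) ≡ b + (a + c)
  +-exchange = solve 3 (λ a b c → (a :+ (b :+ c)) := (b :+ (a :+ c))) refl

  *-+-interchange : ∀ c x y a b → c * (x + y) + (a + b) ≡ (c * x + a) + (c * y + b)
  *-+-interchange = solve 5
    (λ c x y a b → (c :* (x :+ y) :+ (a :+ b)) := ((c :* x :+ a) :+ (c :* y :+ b))) refl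

  *-+-factor : ∀ c β v s → c * (β * v) + s * v ≡ (c * β + s) * v
  *-+-factor = solve 4 (λ c β v s → (c :* (β :* v) :+ s :* v) := ((c :* β :+ s) :* v)) refl

  affine-+ : ∀ w₁ a₁ w₂ a₂ u → (w₁ + a₁ * u) + (w₂ + a₂ * u) ≡ (w₁ + w₂) + (a₁ + a₂) * u
  affine-+ = solve 5 (λ w₁ a₁ w₂ a₂ u →
    ((w₁ :+ a₁ :* u) :+ (w₂ :+ a₂ :* u)) := ((w₁ :+ w₂) :+ (a₁ :+ a₂) :* u)) refl

  affine-* : ∀ c w a u → c * (w + a * u) ≡ c * w + (c * a) * u
  affine-* = solve 4 (λ c w a u → (c :* (w :+ a :* u)) := (c :* w :+ (c :* a) :* u)) refl

  solve-linear : ∀ {a y} x b → a * y ≡ 1# → a * x + b ≡ 0# → x ≡ (- y) * b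
  solve-linear {a} {y} x b ay≡1 ax+b≡0 = sym (begin
    (- y) * b                       ≡⟨ sym (trans (cong ((- y) * b +_) (zeroʳ y)) (+-identityʳ _)) ⟩
    (- y) * b + y * 0#              ≡⟨ cong (λ e → (- y) * b + y * e) (sym ax+b≡0) ⟩
    (- y) * b + y * (a * x + b)     ≡⟨ regroup (- y) ⟩
    ((- y) + y) * b + (a * y) * x   ≡⟨ cong₂ (λ e f → e * b + f * x) (-‿inverseˡ y) ay≡1 ⟩
    0# * b + 1# * x                 ≡⟨ 0*-+ b _ ⟩
    1# * x                          ≡⟨ *-identityˡ x ⟩
    x                               ∎)
    where
    regroup : ∀ ny → ny * b + y * (a * x + b) ≡ (ny + y) * b + (a * y) * x
    regroup ny = solve 5 (λ ny b y a x →
      (ny :* b :+ y :* (a :* x :+ b)) := ((ny :+ y) :* b :+ (a :* y) :* x)) refl ny b y a x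

  eliminate-coordinate : ∀ {a' y} w a w' u → a' * y ≡ 1# →
    (w + a * u) + (- (a * y)) * (w' + a' * u) ≡ w + (- (a * y)) * w'
  eliminate-coordinate {a'} {y} w a w' u a'y≡1 = begin
    (w + a * u) + β * (w' + a' * u)   ≡⟨ regroup ⟩
    (w + β * w') + (a + β * a') * u   ≡⟨ cong (λ e → (w + β * w') + (a + e) * u) βa'≡-a ⟩
    (w + β * w') + (a + - a) * u      ≡⟨ cong (λ e → (w + β * w') + e * u) (-‿inverseʳ a) ⟩
    (w + β * w') + 0# * u             ≡⟨ +-0* _ u ⟩
    w + β * w'                        ∎
    where
    β : L
    β = - (a * y)
    regroup : (w + a * u) + β * (w' + a' * u) ≡ (w + β * w') + (a + β * a') * u
    regroup = solve 6 (λ β w a w' a' u →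
      ((w :+ a :* u) :+ β :* (w' :+ a' :* u)) := ((w :+ β :* w') :+ (a :+ β :* a') :* u))
      refl β w a w' a' u
    aya'≡a : a * y * a' ≡ a
    aya'≡a = begin
      a * y * a'    ≡⟨ solve 3 (λ a y a' → (a :* y :* a') := (a :* (a' :* y))) refl a y a' ⟩
      a * (a' * y)  ≡⟨ cong (a *_) a'y≡1 ⟩
      a * 1#        ≡⟨ *-identityʳ a ⟩
      a             ∎
    βa'≡-a : β * a' ≡ - a
    βa'≡-a = trans (sym (-‿distribˡ-* (a * y) a')) (cong -_ aya'≡a)

module Evasiveness {q n : ℕ} (F : FieldExt q n) (r : ℕ) where
  open FieldExt F
  open VectorSpace F r
  open FieldFacts F
  open IsCommutativeRing isCommutativeRing using (+-comm; +-identityˡ; +-identityʳ; *-identityˡ; zeroˡ)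
  open ≡-Reasoning

  sumL : ∀ {m} → (Fin m → L) → (Fin m → L) → L
  sumL {Nat.zero}  c β = 0#
  sumL {Nat.suc m} c β = c zero * β zero + sumL (λ i → c (suc i)) (λ i → β (suc i))

  lincomb-⊕ : ∀ {d} (c : Fin d → L) (w w' : Fin d → V) →
    lincomb c (λ i → w i ⊕ w' i) ≈ (lincomb c w ⊕ lincomb c w')
  lincomb-⊕ {Nat.zero}  c w w' t = sym (+-identityʳ 0#)
  lincomb-⊕ {Nat.suc d} c w w' t =
    trans (cong (c zero * (w zero t + w' zero t) +_)
                (lincomb-⊕ (λ i → c (suc i)) (λ i → w (suc i)) (λ i → w' (suc i)) t))
          (*-+-interchange _ _ _ _ _)

  lincomb-multiples : ∀ {d} (c β : Fin d → L) (v : V) →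
    lincomb c (λ i → β i · v) ≈ (sumL c β · v)
  lincomb-multiples {Nat.zero}  c β v t = sym (zeroˡ (v t))
  lincomb-multiples {Nat.suc d} c β v t =
    trans (cong (c zero * (β zero * v t) +_)
                (lincomb-multiples (λ i → c (suc i)) (λ i → β (suc i)) v t))
          (*-+-factor _ _ _ _)

  lincomb-insertAt : ∀ {m} (c : Fin m → L) (j : Fin (Nat.suc m)) (a : L) (y : Fin (Nat.suc m) → V) →
    lincomb (insertAt c j a) y ≈ ((a · y j) ⊕ lincomb c (λ i → y (punchIn j i)))
  lincomb-insertAt c zero a y t = refl
  lincomb-insertAt {Nat.suc m} c (suc j) a y t =
    trans (cong (c zero * y zero t +_) (lincomb-insertAt (λ i → c (suc i)) j a (λ i → y (suc i)) t))
          (+-exchange _ _ _)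

  lincomb∈ : (W : V → Set) → IsSubspace ScalL W →
    ∀ {d} (c : Fin d → L) (w : Fin d → V) → (∀ i → W (w i)) → W (lincomb c w)
  lincomb∈ W W-sub {Nat.zero}  c w w∈W = IsSubspace.zero∈ W-sub
  lincomb∈ W W-sub {Nat.suc d} c w w∈W =
    IsSubspace.+∈ W-sub (IsSubspace.·∈ W-sub tt (w∈W zero))
      (lincomb∈ W W-sub (λ i → c (suc i)) (λ i → w (suc i)) (λ i → w∈W (suc i)))

  dimAtLeast-pred : ∀ {S : L → Set} {U : V → Set} {h} → S 0# →
    DimAtLeast S U (Nat.suc h) → DimAtLeast S U h
  dimAtLeast-pred {S} S0 (b , b∈U , bInd) = (λ i → b (suc i)) , (λ i → b∈U (suc i)) , tailInd
    where
    tailInd : Independent S (λ i → b (suc i))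
    tailInd c Sc comb≈0 i = bInd (0# ∷ c) (λ { zero → S0 ; (suc i) → Sc i })
                                 (λ t → trans (0*-+ _ _) (comb≈0 t)) (suc i)

  prepend-independent : (S : L → Set) (W : V → Set) → IsSubspace ScalL W → (u : V) → ¬ W u →
    ∀ {m} (b : Fin m → V) → (∀ i → W (b i)) → Independent S b → Independent S (u ∷ b)
  prepend-independent S W W-sub u u∉W b b∈W bInd c Sc comb≈0 = allZero
    where
    rest : V
    rest = lincomb (λ i → c (suc i)) b
    -- a nonzero coefficient of u would express u as a multiple of rest ∈ W
    head≡0 : c zero ≡ 0#
    head≡0 with c zero ≟ 0#
    ... | yes c₀≡0 = c₀≡0
    ... | no c₀≢0 with inverse (c zero) c₀≢0
    ...   | y , c₀y≡1 = ⊥-elim (u∉W (IsSubspace.resp W-sub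
              (λ t → sym (solve-linear (u t) (rest t) c₀y≡1 (comb≈0 t)))
              (IsSubspace.·∈ W-sub tt (lincomb∈ W W-sub _ b b∈W))))
    allZero : ∀ i → c i ≡ 0#
    allZero zero    = head≡0
    allZero (suc i) = bInd (λ i → c (suc i)) (λ i → Sc (suc i))
      (λ t → trans (sym (0*-+ (u t) (rest t)))
                   (trans (cong (λ e → e * u t + rest t) (sym head≡0)) (comb≈0 t))) i

  -- A relation Σ c_i (y_i + β_i y_j) = 0 is the
  -- relation on y with coefficient Σ c_i β_i inserted at position j.
  eliminate-independent : ∀ {m} (y : Fin (Nat.suc m) → V) → Independent ScalL y →
    (j : Fin (Nat.suc m)) (β : Fin m → L) →
    Independent ScalL (λ i → y (punchIn j i) ⊕ (β i · y j))
  eliminate-independent {m} y yInd j β c _ comb≈0 i = begin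
    c i              ≡⟨ sym (insertAt-punchIn c j α i) ⟩
    C (punchIn j i)  ≡⟨ yInd C (λ _ → tt) C-comb≈0 (punchIn j i) ⟩
    0#               ∎
    where
    α : L
    α = sumL c β
    C : Fin (Nat.suc m) → L
    C = insertAt c j α
    others : Fin m → V
    others i = y (punchIn j i)
    C-comb≈0 : lincomb C y ≈ 0V
    C-comb≈0 t = begin
      lincomb C y t
        ≡⟨ lincomb-insertAt c j α y t ⟩
      α * y j t + lincomb c others t
        ≡⟨ +-comm _ _ ⟩
      lincomb c others t + α * y j t
        ≡⟨ cong (lincomb c others t +_) (sym (lincomb-multiples c β (y j) t)) ⟩
      lincomb c others t + lincomb c (λ i → β i · y j) t
        ≡⟨ sym (lincomb-⊕ c others _ t) ⟩
      lincomb c (λ i → others i ⊕ (β i · y j)) t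
        ≡⟨ comb≈0 t ⟩
      0#
        ∎

  span-¬¬-contained : (U W : V → Set) → IsSubspace ScalL W →
    (∀ {u} → U u → ¬ ¬ W u) → ∀ {v} → SpanL U v → ¬ ¬ W v
  span-¬¬-contained U W W-sub U⊆W (d , w , c , w∈U , v≈comb) v∉W =
    ¬¬-∀-Fin (λ i → W (w i)) (λ i → U⊆W (w∈U i))
      (λ w∈W → v∉W (IsSubspace.resp W-sub (λ t → sym (v≈comb t)) (lincomb∈ W W-sub c w w∈W)))

  escapes-small-subspace : ∀ {h} (U W : V → Set) → IsSubspace ScalL W →
    DimAtLeast ScalL (SpanL U) (Nat.suc h) → DimAtMost ScalL W h →
    ¬ ¬ Σ V (λ u → U u × ¬ W u)
  escapes-small-subspace U W W-sub (b , b∈span , bInd) upper noEscape =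
    ¬¬-∀-Fin (λ i → W (b i))
      (λ i → span-¬¬-contained U W W-sub (λ u∈U u∉W → noEscape (_ , u∈U , u∉W)) (b∈span i))
      (λ b∈W → NatP.<-irrefl refl (upper _ b b∈W bInd))

  module Adjoin (W : V → Set) (W-sub : IsSubspace ScalL W) (u : V) (u∉W : ¬ W u) where

    W' : V → Set
    W' v = Σ L λ a → Σ V λ w → W w × v ≈ (w ⊕ (a · u))

    coefficient : ∀ {v} → W' v → L
    coefficient = proj₁

    component : ∀ {v} → W' v → V
    component p = proj₁ (proj₂ p)

    component∈W : ∀ {v} (p : W' v) → W (component p)
    component∈W p = proj₁ (proj₂ (proj₂ p))

    decomposition : ∀ {v} (p : W' v) → v ≈ (component p ⊕ (coefficient p · u))
    decomposition p = proj₂ (proj₂ (proj₂ p))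

    W'-sub : IsSubspace ScalL W'
    W'-sub = record
      { resp  = λ { v≈v' (a , w , w∈W , v≈) →
                  a , w , w∈W , (λ t → trans (sym (v≈v' t)) (v≈ t)) }
      ; zero∈ = 0# , 0V , IsSubspace.zero∈ W-sub , (λ t → sym (+-0* 0# (u t)))
      ; +∈    = λ { (a₁ , w₁ , w₁∈W , v₁≈) (a₂ , w₂ , w₂∈W , v₂≈) →
                  a₁ + a₂ , w₁ ⊕ w₂ , IsSubspace.+∈ W-sub w₁∈W w₂∈W ,
                  (λ t → trans (cong₂ _+_ (v₁≈ t) (v₂≈ t)) (affine-+ _ _ _ _ _)) }
      ; ·∈    = λ { {c} _ (a , w , w∈W , v≈) →
                  c * a , c · w , IsSubspace.·∈ W-sub tt w∈W ,
                  (λ t → trans (cong (c *_) (v≈ t)) (affine-* _ _ _ _)) }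
      }

    u∈W' : W' u
    u∈W' = 1# , 0V , IsSubspace.zero∈ W-sub ,
           (λ t → sym (trans (+-identityˡ _) (*-identityˡ (u t))))

    W⊆W' : ∀ {v} → W v → W' v
    W⊆W' {v} v∈W = 0# , v , v∈W , (λ t → sym (+-0* (v t) (u t)))

    zero-coefficient⇒∈W : ∀ {v} (p : W' v) → coefficient p ≡ 0# → W v
    zero-coefficient⇒∈W p a≡0 = IsSubspace.resp W-sub
      (λ t → sym (begin
        _                                         ≡⟨ decomposition p t ⟩
        component p t + coefficient p * u t       ≡⟨ cong (λ e → component p t + e * u t) a≡0 ⟩
        component p t + 0# * u t                  ≡⟨ +-0* _ (u t) ⟩
        component p t                             ∎))
      (component∈W p)

    dimAtLeast : ∀ {h} → DimAtLeast ScalL W h → DimAtLeast ScalL W' (Nat.suc h)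
    dimAtLeast (b , b∈W , bInd) =
      u ∷ b , (λ { zero → u∈W' ; (suc i) → W⊆W' (b∈W i) }) ,
      prepend-independent ScalL W W-sub u u∉W b b∈W bInd

    pivot-bound : ∀ {h} → DimAtMost ScalL W h → ∀ {m} (y : Fin (Nat.suc m) → V)
      (y∈W' : ∀ i → W' (y i)) → Independent ScalL y →
      (j : Fin (Nat.suc m)) → ¬ coefficient (y∈W' j) ≡ 0# → m ≤ h
    pivot-bound upper {m} y y∈W' yInd j aⱼ≢0 =
      upper _ (λ i → y (punchIn j i) ⊕ (β i · y j)) eliminated∈W
        (eliminate-independent y yInd j β)
      where
      a : Fin (Nat.suc m) → L
      a i = coefficient (y∈W' i)
      aⱼ⁻¹ : L
      aⱼ⁻¹ = proj₁ (inverse (a j) aⱼ≢0)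
      β : Fin m → L
      β i = - (a (punchIn j i) * aⱼ⁻¹)
      eliminated∈W : ∀ i → W (y (punchIn j i) ⊕ (β i · y j))
      eliminated∈W i = IsSubspace.resp W-sub
        (λ t → sym (trans (cong₂ (λ e e' → e + β i * e')
                                 (decomposition (y∈W' p) t) (decomposition (y∈W' j) t))
                          (eliminate-coordinate _ _ _ (u t) (proj₂ (inverse (a j) aⱼ≢0)))))
        (IsSubspace.+∈ W-sub (component∈W (y∈W' p))
                             (IsSubspace.·∈ W-sub tt (component∈W (y∈W' j))))
        where
        p : Fin (Nat.suc m)
        p = punchIn j i

    -- dim W' ≤ dim W + 1: an independent family in W' either lies in W or
    -- has a member with nonzero u-coefficient to pivot on.
    dimAtMost : ∀ {h} → DimAtMost ScalL W h → DimAtMost ScalL W' (Nat.suc h)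
    dimAtMost upper Nat.zero    y y∈W' yInd = Nat.z≤n
    dimAtMost upper (Nat.suc m) y y∈W' yInd with FinP.all? (λ i → coefficient (y∈W' i) ≟ 0#)
    ... | yes allZero =
      NatP.m≤n⇒m≤1+n (upper _ y (λ i → zero-coefficient⇒∈W (y∈W' i) (allZero i)) yInd)
    ... | no notAllZero with FinP.¬∀⟶∃¬ _ _ (λ i → coefficient (y∈W' i) ≟ 0#) notAllZero
    ...   | j , aⱼ≢0 = Nat.s≤s (pivot-bound upper y y∈W' yInd j aⱼ≢0)

  evasive-step : ∀ h k (U : V → Set) → Evasive (Nat.suc h) k U → Evasive h (k ∸ 1) U
  evasive-step h k U (spanDim , meets) = dimAtLeast-pred {U = SpanL U} tt spanDim , meets'
    where
    meets' : (W : V → Set) → IsSubspace ScalL W → DimAtLeast ScalL W h → DimAtMost ScalL W h →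
      DimAtMost ScalK (λ v → U v × W v) (k ∸ 1)
    meets' W W-sub lower upper d x x∈U∩W xInd =
      decidable-stable (d Nat.≤? k ∸ 1)
        (λ d≰ → escapes-small-subspace U W W-sub spanDim upper
                  (λ (u , u∈U , u∉W) → d≰ (bound u u∈U u∉W)))
      where
      -- u, x_1, …, x_d is F_q-independent in U ∩ (W + ⟨u⟩), and W + ⟨u⟩
      -- has dimension exactly h+1; the double negation on u is discharged
      -- above by decidability of d ≤ k-1.
      bound : (u : V) → U u → ¬ W u → d ≤ k ∸ 1
      bound u u∈U u∉W = NatP.∸-monoˡ-≤ 1
        (meets W' W'-sub (dimAtLeast lower) (dimAtMost upper) (Nat.suc d) (u ∷ x)
          (λ { zero    → u∈U , u∈W'
             ; (suc i) → proj₁ (x∈U∩W i) , W⊆W' (proj₂ (x∈U∩W i)) })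
          (prepend-independent ScalK W W-sub u u∉W x (λ i → proj₂ (x∈U∩W i)) xInd))
        where open Adjoin W W-sub u u∉W

  evasive-descent : ∀ s h k (U : V → Set) → Evasive (s Nat.+ h) k U → Evasive h (k ∸ s) U
  evasive-descent Nat.zero    h k U evasive = evasive
  evasive-descent (Nat.suc s) h k U evasive =
    subst (λ e → Evasive h e U) (NatP.∸-+-assoc k 1 s)
      (evasive-descent s h (k ∸ 1) U (evasive-step (s Nat.+ h) k U evasive))

proposition2p6 : {q n : ℕ} (F : FieldExt q n) (r : ℕ) (h k : ℕ) →
    1 ≤ h → 1 ≤ k →
    (U : VectorSpace.V F r → Set) →
    VectorSpace.IsSubspace F r (VectorSpace.ScalK F r) U →
    VectorSpace.Evasive F r h k U →
    (s : ℕ) → s < h →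
    VectorSpace.Evasive F r (h ∸ s) (k ∸ s) U
proposition2p6 F r h k _ _ U _ evasive s s<h =
  evasive-descent s (h ∸ s) k U
    (subst (λ e → Evasive e k U) (sym (NatP.m+[n∸m]≡n (NatP.<⇒≤ s<h))) evasive)
  where
  open VectorSpace F r using (Evasive)
  open Evasiveness F r using (evasive-descent)
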